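{- Let $\Lambda$ be a non-ordinary numerical semigroup with conductor $c$, subconductor $c'$, dominant $d$, and smallest non-zero element $\lambda_1$. (1) If $\Lambda$ is symmetric then $\min\{c+c'-2,2d\}=c+c'-2=2c-2-\lambda_1$. (2) If $\Lambda$ is pseudo-symmetric then $\min\{c+c'-2,2d\}=c+c'-2$. (3) If $\Lambda$ is Arf then $\min\{c+c'-2,2d\}=2d$. (4) If $\Lambda$ is generated by an interval then $\min\{c+c'-2,2d\}=c+c'-2$.
   Context: A numerical semigroup is a subset $\Lambda\subseteq\mathbb{N}_0$ containing $0$, closed under addition, with finite complement in $\mathbb{N}_0$; $g=\#(\mathbb{N}_0\setminus\Lambda)$ is its genus and the conductor $c$ is the smallest integer with $c+\mathbb{N}_0\subseteq\Lambda$. $\Lambda$ is ordinary if $\Lambda=\{0\}\cup\{i\in\mathbb{N}_0:i\geq c\}$. Symmetric means $c=2g$; pseudo-symmetric means $c=2g-1$. With enumeration $\lambda$ (increasing bijection $\mathbb{N}_0\to\Lambda$), Arf means $\lambda_a+\lambda_b-\lambda_k\in\Lambda$ for all $a\geq b\geq k$. Generated by the interval $\{i,\dots,j\}$ ($1\le i\le j$) means $\Lambda=\{n_i i+\dots+n_j j: n_i,\dots,n_j\in\mathbb{N}_0\}$. For $\Lambda\neq\mathbb{N}_0$, the dominant $d$ is the largest element of $\Lambda$ smaller than $c$, and the subconductor $c'$ is the smallest element of $\Lambda$ such that every integer in $[c',d]$ lies in $\Lambda$. -}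

module Defs where

open import Data.Nat using (ℕ; zero; suc; _+_; _*_; _∸_; _≤_; _<_)
open import Data.Bool using (Bool; true; false; if_then_else_)
open import Data.List using (List; map; upTo)
open import Data.Nat.ListAction using (sum)
open import Data.Product using (_×_; Σ; ∃)
open import Data.Sum using (_⊎_)
open import Relation.Binary.PropositionalEquality using (_≡_)
open import Relation.Nullary using (¬_)
open import Function.Bundles using (_⇔_)

Subset : Set
Subset = ℕ → Bool

_∈_ : ℕ → Subset → Set
n ∈ Λ = Λ n ≡ true

record IsNumericalSemigroup (Λ : Subset) : Set where
  field
    has-zero   : 0 ∈ Λ
    closed-add : ∀ a b → a ∈ Λ → b ∈ Λ → (a + b) ∈ Λ
    cofinite   : ∃ λ N → ∀ n → N ≤ n → n ∈ Λ

IsConductor : Subset → ℕ → Set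
IsConductor Λ c =
  (∀ n → c ≤ n → n ∈ Λ) × (∀ c₀ → (∀ n → c₀ ≤ n → n ∈ Λ) → c ≤ c₀)

gapsBelow : Subset → ℕ → ℕ
gapsBelow Λ zero = 0
gapsBelow Λ (suc n) = gapsBelow Λ n + (if Λ n then 0 else 1)

-- g is the genus #(ℕ₀ ∖ Λ); all gaps lie below the conductor c.
IsGenus : Subset → ℕ → Set
IsGenus Λ g = ∃ λ c → IsConductor Λ c × g ≡ gapsBelow Λ c

IsOrdinary : Subset → ℕ → Set
IsOrdinary Λ c = ∀ i → (i ∈ Λ) ⇔ (i ≡ 0 ⊎ c ≤ i)

IsSymmetric : Subset → Set
IsSymmetric Λ = Σ ℕ λ c → Σ ℕ λ g → IsConductor Λ c × IsGenus Λ g × c ≡ 2 * g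

IsPseudoSymmetric : Subset → Set
IsPseudoSymmetric Λ =
  Σ ℕ λ c → Σ ℕ λ g → IsConductor Λ c × IsGenus Λ g × c ≡ 2 * g ∸ 1

IsEnumeration : Subset → (ℕ → ℕ) → Set
IsEnumeration Λ λ' =
  (∀ i j → i < j → λ' i < λ' j) × (∀ n → (n ∈ Λ) ⇔ (∃ λ i → λ' i ≡ n))

IsArf : Subset → (ℕ → ℕ) → Set
IsArf Λ λ' = ∀ a b k → b ≤ a → k ≤ b → (λ' a + λ' b ∸ λ' k) ∈ Λ

interval : ℕ → ℕ → List ℕ
interval i j = map (i +_) (upTo (suc (j ∸ i)))

GeneratedByInterval : Subset → ℕ → ℕ → Set
GeneratedByInterval Λ i j =
  1 ≤ i × i ≤ j ×
  (∀ n → (n ∈ Λ) ⇔ (∃ λ (coef : ℕ → ℕ) → n ≡ sum (map (λ k → coef k * k) (interval i j))))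

IsGeneratedByAnInterval : Subset → Set
IsGeneratedByAnInterval Λ = Σ ℕ λ i → Σ ℕ λ j → GeneratedByInterval Λ i j

IsDominant : Subset → ℕ → ℕ → Set
IsDominant Λ c d = d ∈ Λ × d < c × (∀ x → x ∈ Λ → x < c → x ≤ d)

IsSubconductor : Subset → ℕ → ℕ → Set
IsSubconductor Λ d c' =
  c' ∈ Λ × (∀ i → c' ≤ i → i ≤ d → i ∈ Λ) ×
  (∀ x → x ∈ Λ → (∀ i → x ≤ i → i ≤ d → i ∈ Λ) → c' ≤ x)

module Submission where

-- Write c = c₁ + 2 (so c - 1 = c₁ + 1 is a gap and d ≤ c₁).  Two elementary
-- observations decide the minimum: if c - 2 ∈ Λ then d = c - 2 ≥ c' and the
-- minimum is c + c' - 2; if d ≤ c' then it is 2d.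
--  * Gap counting.  Since c - 1 is a gap, x and c - 1 - x are never both
--    elements, whence 2g = c + P with P the number of x < c such that x and
--    c - 1 - x are both gaps.  Symmetric means P = 0, pseudo-symmetric P = 1;
--    if c - 2 were a gap, x = 1 and x = c - 2 would give P ≥ 2.  When P = 0
--    the map x ↦ c - 1 - x sends gaps to elements, which yields c' + m = c.
--  * Arf: if c' < d then d - 1, d ∈ Λ and the Arf condition gives d + 1 ∈ Λ.
--  * Interval {i,…,j}: Λ is the union of the blocks [K i, K j]; comparing the
--    block ending at d with the two following ones bounds c + c' by 2d + 2.
-- The file develops finite sums, gap counting, enumerations and interval
-- generated semigroups in general, then the four cases, then the theorem.

open import Defs
open import Data.Bool using (true; false; if_then_else_)
open import Data.Bool.Properties using (¬-not) renaming (_≟_ to _≟ᴮ_)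
open import Data.Empty using (⊥-elim)
open import Data.List using (List; []; _∷_; map; applyUpTo)
open import Data.List.Properties using (map-upTo)
open import Data.List.Relation.Unary.All using (All; []; _∷_)
open import Data.Nat using (ℕ; zero; suc; pred; >-nonZero; _+_; _*_; _∸_; _⊓_; _≤_; _<_; _≟_; _≤?_; _<?_; z≤n; s≤s; s≤s⁻¹)
open import Data.Nat.ListAction using (sum)
open import Data.Nat.Properties
open import Data.Nat.Tactic.RingSolver using (solve-∀)
open import Data.Product using (_×_; ∃; _,_; proj₁; proj₂)
open import Data.Sum using (_⊎_; inj₁; inj₂)
open import Function.Bundles using (Equivalence; mk⇔)
open import Relation.Binary.PropositionalEquality using (_≡_; _≢_; refl; sym; trans; cong; cong₂; subst; subst₂; module ≡-Reasoning)
open import Relation.Nullary using (¬_; yes; no)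

sumBelow : ℕ → (ℕ → ℕ) → ℕ
sumBelow zero    f = 0
sumBelow (suc n) f = sumBelow n f + f n

sumBelow-head : ∀ n f → sumBelow (suc n) f ≡ f 0 + sumBelow n (λ x → f (suc x))
sumBelow-head zero    f = +-comm 0 (f 0)
sumBelow-head (suc n) f = trans (cong (_+ f (suc n)) (sumBelow-head n f)) (+-assoc (f 0) _ _)

sumBelow-reflect : ∀ n f → sumBelow n (λ x → f (n ∸ suc x)) ≡ sumBelow n f
sumBelow-reflect zero    f = refl
sumBelow-reflect (suc n) f = begin
  sumBelow (suc n) (λ x → f (n ∸ x))     ≡⟨ sumBelow-head n _ ⟩
  f n + sumBelow n (λ x → f (n ∸ suc x)) ≡⟨ cong (f n +_) (sumBelow-reflect n f) ⟩
  f n + sumBelow n f                     ≡⟨ +-comm (f n) _ ⟩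
  sumBelow (suc n) f                     ∎
  where open ≡-Reasoning

sumBelow-+ : ∀ n f g → sumBelow n (λ x → f x + g x) ≡ sumBelow n f + sumBelow n g
sumBelow-+ zero    f g = refl
sumBelow-+ (suc n) f g =
  trans (cong (_+ (f n + g n)) (sumBelow-+ n f g)) (interchange (sumBelow n f) (sumBelow n g) (f n) (g n))
  where
  interchange : ∀ a b x y → (a + b) + (x + y) ≡ (a + x) + (b + y)
  interchange = solve-∀

sumBelow-1+ : ∀ n f → sumBelow n (λ x → 1 + f x) ≡ n + sumBelow n f
sumBelow-1+ zero    f = refl
sumBelow-1+ (suc n) f = trans (cong (_+ (1 + f n)) (sumBelow-1+ n f)) (shuffle n (sumBelow n f) (f n))
  where
  shuffle : ∀ n s y → (n + s) + (1 + y) ≡ suc n + (s + y)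
  shuffle = solve-∀

sumBelow-cong : ∀ n {f g : ℕ → ℕ} → (∀ x → x < n → f x ≡ g x) → sumBelow n f ≡ sumBelow n g
sumBelow-cong zero    eq = refl
sumBelow-cong (suc n) eq = cong₂ _+_ (sumBelow-cong n (λ x x<n → eq x (m<n⇒m<1+n x<n))) (eq n (n<1+n n))

sumBelow-mono : ∀ f {m n} → m ≤ n → sumBelow m f ≤ sumBelow n f
sumBelow-mono f {n = zero}  z≤n = ≤-refl
sumBelow-mono f {n = suc n} m≤1+n with m≤n⇒m<n∨m≡n m≤1+n
... | inj₁ m<1+n = ≤-trans (sumBelow-mono f (s≤s⁻¹ m<1+n)) (m≤m+n _ (f n))
... | inj₂ refl  = ≤-refl

term≤sumBelow : ∀ f {a n} → a < n → f a ≤ sumBelow n f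
term≤sumBelow f {a} a<n = ≤-trans (m≤n+m (f a) (sumBelow a f)) (sumBelow-mono f a<n)

twoTerms≤sumBelow : ∀ f {a b n} → a < b → b < n → f a + f b ≤ sumBelow n f
twoTerms≤sumBelow f {a} {b} a<b b<n =
  ≤-trans (+-monoˡ-≤ (f b) (term≤sumBelow f a<b)) (sumBelow-mono f b<n)

-- Counting gaps in pairs {x, c₀ - x}

isGap : Subset → ℕ → ℕ
isGap Λ x = if Λ x then 0 else 1

isGap-gap : ∀ (Λ : Subset) {x} → ¬ x ∈ Λ → isGap Λ x ≡ 1
isGap-gap Λ {x} x∉ rewrite ¬-not x∉ = refl

gapsBelow≡sumBelow : ∀ Λ n → gapsBelow Λ n ≡ sumBelow n (isGap Λ)
gapsBelow≡sumBelow Λ zero    = refl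
gapsBelow≡sumBelow Λ (suc n) = cong (_+ isGap Λ n) (gapsBelow≡sumBelow Λ n)

isGap-pair : ∀ (Λ : Subset) x y → ¬ (x ∈ Λ × y ∈ Λ) →
             isGap Λ x + isGap Λ y ≡ 1 + isGap Λ x * isGap Λ y
isGap-pair Λ x y notBoth with Λ x | Λ y
... | true  | true  = ⊥-elim (notBoth (refl , refl))
... | true  | false = refl
... | false | true  = refl
... | false | false = refl

gapPairs : Subset → ℕ → ℕ
gapPairs Λ c₀ = sumBelow (suc c₀) (λ x → isGap Λ x * isGap Λ (c₀ ∸ x))

gap-count : ∀ Λ c₀ → (∀ x → x ≤ c₀ → ¬ (x ∈ Λ × (c₀ ∸ x) ∈ Λ)) →
            2 * gapsBelow Λ (suc c₀) ≡ suc c₀ + gapPairs Λ c₀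
gap-count Λ c₀ notBoth = begin
  2 * gapsBelow Λ (suc c₀)                               ≡⟨ cong (2 *_) (gapsBelow≡sumBelow Λ (suc c₀)) ⟩
  G + (G + 0)                                            ≡⟨ cong (G +_) (+-identityʳ G) ⟩
  G + G                                                  ≡⟨ cong (G +_) (sym (sumBelow-reflect (suc c₀) (isGap Λ))) ⟩
  G + sumBelow (suc c₀) (λ x → isGap Λ (c₀ ∸ x))         ≡⟨ sym (sumBelow-+ (suc c₀) (isGap Λ) _) ⟩
  sumBelow (suc c₀) (λ x → isGap Λ x + isGap Λ (c₀ ∸ x)) ≡⟨ sumBelow-cong (suc c₀) pairwise ⟩
  sumBelow (suc c₀) (λ x → 1 + isGap Λ x * isGap Λ (c₀ ∸ x)) ≡⟨ sumBelow-1+ (suc c₀) _ ⟩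
  suc c₀ + gapPairs Λ c₀                                 ∎
  where
  open ≡-Reasoning
  G : ℕ
  G = sumBelow (suc c₀) (isGap Λ)
  pairwise : ∀ x → x < suc c₀ →
             isGap Λ x + isGap Λ (c₀ ∸ x) ≡ 1 + isGap Λ x * isGap Λ (c₀ ∸ x)
  pairwise x x<1+c₀ = isGap-pair Λ x (c₀ ∸ x) (notBoth x (s≤s⁻¹ x<1+c₀))

conductor-unique : ∀ {Λ a b} → IsConductor Λ a → IsConductor Λ b → a ≡ b
conductor-unique (a-ok , a-least) (b-ok , b-least) = ≤-antisym (a-least _ b-ok) (b-least _ a-ok)

genus≡gapsBelow : ∀ {Λ c g} → IsConductor Λ c → IsGenus Λ g → g ≡ gapsBelow Λ c
genus≡gapsBelow {Λ} cond (c₂ , cond₂ , g≡) = trans g≡ (cong (gapsBelow Λ) (conductor-unique cond₂ cond))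

-- c - 1 is a gap, otherwise c - 1 would be a smaller conductor.
conductor-pred-gap : ∀ {Λ c₀} → IsConductor Λ (suc c₀) → ¬ c₀ ∈ Λ
conductor-pred-gap {Λ} {c₀} (above , least) c₀∈ = 1+n≰n (least c₀ above-c₀)
  where
  above-c₀ : ∀ n → c₀ ≤ n → n ∈ Λ
  above-c₀ n c₀≤n with c₀ ≟ n
  ... | yes refl = c₀∈
  ... | no  c₀≢n = above n (≤∧≢⇒< c₀≤n c₀≢n)

-- c' - 1 is a gap (for c' > 0), otherwise c' - 1 would be a smaller subconductor.
subconductor-pred-gap : ∀ {Λ d c'} → IsSubconductor Λ d c' → 0 < c' → ¬ pred c' ∈ Λ
subconductor-pred-gap {Λ} {d} {suc p} (_ , inside , least) _ p∈ = 1+n≰n (least p p∈ inside-p)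
  where
  inside-p : ∀ t → p ≤ t → t ≤ d → t ∈ Λ
  inside-p t p≤t t≤d with p ≟ t
  ... | yes refl = p∈
  ... | no  p≢t  = inside t (≤∧≢⇒< p≤t p≢t) t≤d

module Semigroup {Λ : Subset} (NS : IsNumericalSemigroup Λ) where
  open IsNumericalSemigroup NS

  one∈⇒everything : 1 ∈ Λ → ∀ n → n ∈ Λ
  one∈⇒everything 1∈ zero    = has-zero
  one∈⇒everything 1∈ (suc n) = closed-add 1 n 1∈ (one∈⇒everything 1∈ n)

  no-complementary-pair : ∀ {c₀} → ¬ c₀ ∈ Λ → ∀ x → x ≤ c₀ → ¬ (x ∈ Λ × (c₀ ∸ x) ∈ Λ)
  no-complementary-pair c₀∉ x x≤c₀ (x∈ , y∈) =
    c₀∉ (subst (_∈ Λ) (m+[n∸m]≡n x≤c₀) (closed-add _ _ x∈ y∈))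

  conductor-shape : ∀ {c d} → IsConductor Λ c → IsDominant Λ c d → ∃ λ c₁ → c ≡ suc (suc c₁)
  conductor-shape {zero}         _    (_ , () , _)
  conductor-shape {suc zero}     cond _ = ⊥-elim (conductor-pred-gap cond has-zero)
  conductor-shape {suc (suc c₁)} _    _ = c₁ , refl

module Enumeration {Λ : Subset} (NS : IsNumericalSemigroup Λ) {λ' : ℕ → ℕ} (enum : IsEnumeration Λ λ') where
  open IsNumericalSemigroup NS

  strict : ∀ i j → i < j → λ' i < λ' j
  strict = proj₁ enum

  monotone : ∀ {i j} → i ≤ j → λ' i ≤ λ' j
  monotone {i} {j} i≤j with m≤n⇒m<n∨m≡n i≤j
  ... | inj₁ i<j = <⇒≤ (strict i j i<j)
  ... | inj₂ refl = ≤-refl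

  reflects-≤ : ∀ {k i} → λ' k ≤ λ' i → k ≤ i
  reflects-≤ {k} {i} λk≤λi with i <? k
  ... | yes i<k = ⊥-elim (<⇒≱ (strict i k i<k) λk≤λi)
  ... | no  i≮k = ≮⇒≥ i≮k

  index : ∀ {n} → n ∈ Λ → ∃ λ i → λ' i ≡ n
  index {n} = Equivalence.to (proj₂ enum n)

  λ-zero : λ' 0 ≡ 0
  λ-zero with index has-zero
  ... | k , λk≡0 = n≤0⇒n≡0 (subst (λ' 0 ≤_) λk≡0 (monotone z≤n))

  λ-one∈ : λ' 1 ∈ Λ
  λ-one∈ = Equivalence.from (proj₂ enum _) (1 , refl)

  λ-one-positive : 0 < λ' 1
  λ-one-positive = subst (_< λ' 1) λ-zero (strict 0 1 (s≤s z≤n))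

  λ-one-least : ∀ x → x ∈ Λ → 0 < x → λ' 1 ≤ x
  λ-one-least x x∈ 0<x with index x∈
  ... | zero  , λ0≡x = ⊥-elim (<-irrefl (trans (sym λ-zero) λ0≡x) 0<x)
  ... | suc k , λk≡x = subst (λ' 1 ≤_) λk≡x (monotone (s≤s z≤n))

  -- Arf: with x - 1 and x also x + 1 = x + x - (x - 1) is an element.
  arf-successor : IsArf Λ λ' → ∀ x → 0 < x → pred x ∈ Λ → x ∈ Λ → suc x ∈ Λ
  arf-successor arf (suc e) _ e∈ x∈ with index x∈ | index e∈
  ... | i , λi≡x | k , λk≡e = subst (_∈ Λ) arf-value (arf i i k ≤-refl k≤i)
    where
    k≤i : k ≤ i
    k≤i = reflects-≤ (subst₂ _≤_ (sym λk≡e) (sym λi≡x) (n≤1+n e))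
    double : ∀ e → suc e + suc e ≡ e + suc (suc e)
    double = solve-∀
    arf-value : λ' i + λ' i ∸ λ' k ≡ suc (suc e)
    arf-value = begin
      λ' i + λ' i ∸ λ' k   ≡⟨ cong₂ (λ a b → a + a ∸ b) λi≡x λk≡e ⟩
      suc e + suc e ∸ e    ≡⟨ cong (_∸ e) (double e) ⟩
      e + suc (suc e) ∸ e  ≡⟨ m+n∸m≡n e _ ⟩
      suc (suc e)          ∎
      where open ≡-Reasoning

-- Semigroups generated by an interval

consecutive : ℕ → ℕ → List ℕ
consecutive a zero    = []
consecutive a (suc n) = a ∷ consecutive (suc a) n

applyUpTo-offset : ∀ a n (f : ℕ → ℕ) → (∀ x → f x ≡ a + x) → applyUpTo f n ≡ consecutive a n
applyUpTo-offset a zero    f f≡ = refl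
applyUpTo-offset a (suc n) f f≡ =
  cong₂ _∷_ (trans (f≡ 0) (+-identityʳ a))
            (applyUpTo-offset (suc a) n (λ x → f (suc x)) (λ x → trans (f≡ (suc x)) (+-suc a x)))

interval≡consecutive : ∀ i j → interval i j ≡ consecutive i (suc (j ∸ i))
interval≡consecutive i j = trans (map-upTo (i +_) _) (applyUpTo-offset i _ (i +_) (λ _ → refl))

consecutive-above : ∀ a n {l} → l ≤ a → All (l ≤_) (consecutive a n)
consecutive-above a zero    _   = []
consecutive-above a (suc n) l≤a = l≤a ∷ consecutive-above (suc a) n (m≤n⇒m≤1+n l≤a)

consecutive-below : ∀ a n {u} → a + n ≤ suc u → All (_≤ u) (consecutive a n)
consecutive-below a zero    _     = []
consecutive-below a (suc n) {u} bound = m+n≤o⇒m≤o a (s≤s⁻¹ bound′) ∷ consecutive-below (suc a) n bound′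
  where
  bound′ : suc a + n ≤ suc u
  bound′ = subst (_≤ suc u) (+-suc a n) bound

weighted : (ℕ → ℕ) → List ℕ → ℕ
weighted coef xs = sum (map (λ k → coef k * k) xs)

weighted-lower : ∀ coef {l} xs → All (l ≤_) xs → sum (map coef xs) * l ≤ weighted coef xs
weighted-lower coef         []       []           = z≤n
weighted-lower coef {l} (x ∷ xs) (l≤x ∷ l≤xs) = begin
  (coef x + sum (map coef xs)) * l   ≡⟨ *-distribʳ-+ l (coef x) _ ⟩
  coef x * l + sum (map coef xs) * l ≤⟨ +-mono-≤ (*-monoʳ-≤ (coef x) l≤x) (weighted-lower coef xs l≤xs) ⟩
  coef x * x + weighted coef xs      ∎
  where open ≤-Reasoning

weighted-upper : ∀ coef {u} xs → All (_≤ u) xs → weighted coef xs ≤ sum (map coef xs) * u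
weighted-upper coef         []       []           = z≤n
weighted-upper coef {u} (x ∷ xs) (x≤u ∷ xs≤u) = begin
  coef x * x + weighted coef xs      ≤⟨ +-mono-≤ (*-monoʳ-≤ (coef x) x≤u) (weighted-upper coef xs xs≤u) ⟩
  coef x * u + sum (map coef xs) * u ≡⟨ sym (*-distribʳ-+ u (coef x) _) ⟩
  (coef x + sum (map coef xs)) * u   ∎
  where open ≤-Reasoning

single : ℕ → ℕ → ℕ
single zero    zero    = 1
single zero    (suc k) = 0
single (suc t) zero    = 0
single (suc t) (suc k) = single t k

single-self : ∀ t → single t t ≡ 1
single-self zero    = refl
single-self (suc t) = single-self t

single-other : ∀ t k → k ≢ t → single t k ≡ 0
single-other zero    zero    k≢t = ⊥-elim (k≢t refl)
single-other zero    (suc k) _   = refl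
single-other (suc t) zero    _   = refl
single-other (suc t) (suc k) k≢t = single-other t k (λ k≡t → k≢t (cong suc k≡t))

weighted-single-absent : ∀ t a n → t < a → weighted (single t) (consecutive a n) ≡ 0
weighted-single-absent t a zero    _   = refl
weighted-single-absent t a (suc n) t<a =
  cong₂ _+_ (cong (_* a) (single-other t a (λ a≡t → <-irrefl (sym a≡t) t<a)))
            (weighted-single-absent t (suc a) n (m<n⇒m<1+n t<a))

weighted-single : ∀ t a n → a ≤ t → t < a + n → weighted (single t) (consecutive a n) ≡ t
weighted-single t a zero    a≤t t<a+0 = ⊥-elim (<⇒≱ (subst (t <_) (+-identityʳ a) t<a+0) a≤t)
weighted-single t a (suc n) a≤t t<a+n with a ≟ t
... | yes refl = trans (cong₂ _+_ (trans (cong (_* t) (single-self t)) (*-identityˡ t))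
                                  (weighted-single-absent t (suc t) n (n<1+n t)))
                       (+-identityʳ t)
... | no  a≢t  = trans (cong (λ h → h * a + weighted (single t) (consecutive (suc a) n)) (single-other t a a≢t))
                       (weighted-single t (suc a) n (≤∧≢⇒< a≤t a≢t) (subst (t <_) (+-suc a n) t<a+n))

-- Λ generated by {i,…,j} is the union of the blocks [K i, K j], K ∈ ℕ.
module IntervalGenerated {Λ : Subset} (NS : IsNumericalSemigroup Λ) {i j : ℕ}
                         (GI : GeneratedByInterval Λ i j) where
  open IsNumericalSemigroup NS

  i≤j : i ≤ j
  i≤j = proj₁ (proj₂ GI)

  represents : ∀ n → (n ∈ Λ) → ∃ λ coef → n ≡ weighted coef (consecutive i (suc (j ∸ i)))
  represents n n∈ with Equivalence.to (proj₂ (proj₂ GI) n) n∈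
  ... | coef , n≡ = coef , trans n≡ (cong (weighted coef) (interval≡consecutive i j))

  i+length≡1+j : i + suc (j ∸ i) ≡ suc j
  i+length≡1+j = trans (+-suc i (j ∸ i)) (cong suc (m+[n∸m]≡n i≤j))

  generator∈ : ∀ t → i ≤ t → t ≤ j → t ∈ Λ
  generator∈ t i≤t t≤j = Equivalence.from (proj₂ (proj₂ GI) t) (single t , sym value)
    where
    value : weighted (single t) (interval i j) ≡ t
    value = trans (cong (weighted (single t)) (interval≡consecutive i j))
                  (weighted-single t i _ i≤t (subst (t <_) (sym i+length≡1+j) (s≤s t≤j)))

  member⇒block : ∀ n → n ∈ Λ → ∃ λ K → K * i ≤ n × n ≤ K * j
  member⇒block n n∈ with represents n n∈
  ... | coef , n≡ = sum (map coef xs)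
                  , subst (_ ≤_) (sym n≡) (weighted-lower coef xs (consecutive-above i _ ≤-refl))
                  , subst (_≤ _) (sym n≡) (weighted-upper coef xs (consecutive-below i _ (≤-reflexive i+length≡1+j)))
    where
    xs : List ℕ
    xs = consecutive i (suc (j ∸ i))

  -- n ∈ [(K+1) i, (K+1) j] is either i + (element of [K i, K j]) or
  -- (a generator) + K j.
  block⇒member : ∀ K n → K * i ≤ n → n ≤ K * j → n ∈ Λ
  block⇒member zero    n _     n≤0   = subst (_∈ Λ) (sym (n≤0⇒n≡0 n≤0)) has-zero
  block⇒member (suc K) n lower upper with n ∸ i ≤? K * j
  ... | yes rest≤Kj = subst (_∈ Λ) (m+[n∸m]≡n i≤n)
                        (closed-add _ _ (generator∈ i ≤-refl i≤j) (block⇒member K (n ∸ i) Ki≤rest rest≤Kj))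
    where
    i≤n : i ≤ n
    i≤n = m+n≤o⇒m≤o i lower
    Ki≤rest : K * i ≤ n ∸ i
    Ki≤rest = m+n≤o⇒m≤o∸n (K * i) (subst (_≤ n) (+-comm i (K * i)) lower)
  ... | no  rest≰Kj = subst (_∈ Λ) (m∸n+n≡m Kj≤n)
                        (closed-add _ _ (generator∈ (n ∸ K * j) i≤top top≤j)
                                        (block⇒member K (K * j) (*-monoʳ-≤ K i≤j) ≤-refl))
    where
    i+Kj≤n : i + K * j ≤ n
    i+Kj≤n = ≤-trans (≤-reflexive (+-comm i (K * j)))
               (≤-trans (n≤1+n _) (m≤o∸n⇒m+n≤o (suc (K * j)) (m+n≤o⇒m≤o i lower) (≰⇒> rest≰Kj)))
    Kj≤n : K * j ≤ n
    Kj≤n = m+n≤o⇒n≤o i i+Kj≤n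
    i≤top : i ≤ n ∸ K * j
    i≤top = m+n≤o⇒m≤o∸n i i+Kj≤n
    top≤j : n ∸ K * j ≤ j
    top≤j = m≤n+o⇒m∸n≤o n (K * j) (subst (n ≤_) (+-comm j (K * j)) upper)

symmetric-arithmetic : ∀ c c' m → c' + m ≡ c → c + c' ∸ 2 ≡ 2 * c ∸ 2 ∸ m
symmetric-arithmetic _ c' m refl = sym (begin
  2 * (c' + m) ∸ 2 ∸ m          ≡⟨ ∸-+-assoc (2 * (c' + m)) 2 m ⟩
  2 * (c' + m) ∸ (2 + m)        ≡⟨ cong₂ _∸_ (regroup c' m) (+-comm 2 m) ⟩
  m + ((c' + m) + c') ∸ (m + 2) ≡⟨ [m+n]∸[m+o]≡n∸o m _ 2 ⟩
  (c' + m) + c' ∸ 2             ∎)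
  where
  open ≡-Reasoning
  regroup : ∀ c' m → 2 * (c' + m) ≡ m + ((c' + m) + c')
  regroup = solve-∀

-- Adding k i ≤ k j to (k+3) i ≤ (k+2) j + 1 bounds (2k+3) i by 2 (k+1) j + 2.
interval-arithmetic : ∀ k i j → i ≤ j → suc (suc (suc k)) * i ≤ suc (suc k) * j + 1 →
                      suc (suc k) * i + suc k * i ≤ 2 * (suc k * j) + 2
interval-arithmetic k i j i≤j blocks-meet = begin
  suc (suc k) * i + suc k * i      ≡⟨ regroup k i ⟩
  suc (suc (suc k)) * i + k * i    ≤⟨ +-mono-≤ blocks-meet (*-monoʳ-≤ k i≤j) ⟩
  (suc (suc k) * j + 1) + k * j    ≡⟨ collect k j ⟩
  2 * (suc k * j) + 1              ≤⟨ +-monoʳ-≤ (2 * (suc k * j)) (n≤1+n 1) ⟩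
  2 * (suc k * j) + 2              ∎
  where
  open ≤-Reasoning
  regroup : ∀ k i → suc (suc k) * i + suc k * i ≡ suc (suc (suc k)) * i + k * i
  regroup = solve-∀
  collect : ∀ k j → (suc (suc k) * j + 1) + k * j ≡ 2 * (suc k * j) + 1
  collect = solve-∀

module NonOrdinary {Λ : Subset} (NS : IsNumericalSemigroup Λ) {c₁ c' d : ℕ}
    (cond : IsConductor Λ (suc (suc c₁))) (nonord : ¬ IsOrdinary Λ (suc (suc c₁)))
    (dom : IsDominant Λ (suc (suc c₁)) d) (sub : IsSubconductor Λ d c') where
  open IsNumericalSemigroup NS
  open Semigroup NS

  c : ℕ
  c = suc (suc c₁)

  c-2<c : c₁ < c
  c-2<c = m<n⇒m<1+n (n<1+n c₁)

  d∈ : d ∈ Λ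
  d∈ = proj₁ dom

  ≤dominant : ∀ x → x ∈ Λ → x < c → x ≤ d
  ≤dominant = proj₂ (proj₂ dom)

  [c',d]⊆Λ : ∀ t → c' ≤ t → t ≤ d → t ∈ Λ
  [c',d]⊆Λ = proj₁ (proj₂ sub)

  c'-least : ∀ x → x ∈ Λ → (∀ t → x ≤ t → t ≤ d → t ∈ Λ) → c' ≤ x
  c'-least = proj₂ (proj₂ sub)

  c-1∉ : ¬ suc c₁ ∈ Λ
  c-1∉ = conductor-pred-gap cond

  1∉ : ¬ 1 ∈ Λ
  1∉ 1∈ = c-1∉ (one∈⇒everything 1∈ (suc c₁))

  d≤c-2 : d ≤ c₁
  d≤c-2 with m≤n⇒m<n∨m≡n (s≤s⁻¹ (proj₁ (proj₂ dom)))
  ... | inj₁ d<c-1 = s≤s⁻¹ d<c-1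
  ... | inj₂ refl  = ⊥-elim (c-1∉ d∈)

  -- A dominant 0 would make Λ ordinary.
  1≤d : 1 ≤ d
  1≤d with d ≟ 0
  ... | no  d≢0 = n≢0⇒n>0 d≢0
  ... | yes refl = ⊥-elim (nonord ordinary)
    where
    ordinary : IsOrdinary Λ c
    ordinary x = mk⇔ to from
      where
      to : x ∈ Λ → x ≡ 0 ⊎ c ≤ x
      to x∈ with x <? c
      ... | yes x<c = inj₁ (n≤0⇒n≡0 (≤dominant x x∈ x<c))
      ... | no  x≮c = inj₂ (≮⇒≥ x≮c)
      from : x ≡ 0 ⊎ c ≤ x → x ∈ Λ
      from (inj₁ refl) = has-zero
      from (inj₂ c≤x)  = proj₁ cond x c≤x

  c'≤d : c' ≤ d
  c'≤d = c'-least d d∈ (λ t d≤t t≤d → subst (_∈ Λ) (≤-antisym d≤t t≤d) d∈)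

  0<c' : 0 < c'
  0<c' = n≢0⇒n>0 (λ c'≡0 → 1∉ ([c',d]⊆Λ 1 (subst (_≤ 1) (sym c'≡0) z≤n) 1≤d))

  d+1∉ : ¬ suc d ∈ Λ
  d+1∉ d+1∈ = 1+n≰n (≤dominant (suc d) d+1∈ (s≤s (s≤s d≤c-2)))

  -- If c - 2 ∈ Λ then d = c - 2 ≥ c', so the minimum is c + c' - 2.
  min-if-c-2∈ : c₁ ∈ Λ → (c + c' ∸ 2) ⊓ (2 * d) ≡ c + c' ∸ 2
  min-if-c-2∈ c₁∈ = m≤n⇒m⊓n≡m (begin
    c₁ + c' ≤⟨ +-mono-≤ (≤dominant c₁ c₁∈ c-2<c) c'≤d ⟩
    d + d   ≡⟨ cong (d +_) (sym (+-identityʳ d)) ⟩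
    2 * d   ∎)
    where open ≤-Reasoning

  -- If d ≤ c' then, as d ≤ c - 2, the minimum is 2d.
  min-if-d≤c' : d ≤ c' → (c + c' ∸ 2) ⊓ (2 * d) ≡ 2 * d
  min-if-d≤c' d≤c' = m≥n⇒m⊓n≡n (begin
    2 * d   ≡⟨ cong (d +_) (+-identityʳ d) ⟩
    d + d   ≤⟨ +-mono-≤ d≤c-2 d≤c' ⟩
    c₁ + c' ∎)
    where open ≤-Reasoning

  pairs : ℕ
  pairs = gapPairs Λ (suc c₁)

  twice-genus : 2 * gapsBelow Λ c ≡ c + pairs
  twice-genus = gap-count Λ (suc c₁) (no-complementary-pair c-1∉)

  -- If c - 2 is a gap then x = 1 and x = c - 2 are two gap pairs.
  two-pairs-if-c-2∉ : ¬ c₁ ∈ Λ → 2 ≤ pairs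
  two-pairs-if-c-2∉ c₁∉ = begin
    1 + 1            ≡⟨ cong₂ _+_ (sym pair-at-1) (sym pair-at-c-2) ⟩
    pair 1 + pair c₁ ≤⟨ twoTerms≤sumBelow pair 1<c-2 c-2<c ⟩
    pairs            ∎
    where
    open ≤-Reasoning
    pair : ℕ → ℕ
    pair x = isGap Λ x * isGap Λ (suc c₁ ∸ x)
    pair-at-1 : pair 1 ≡ 1
    pair-at-1 = cong₂ _*_ (isGap-gap Λ 1∉) (isGap-gap Λ c₁∉)
    pair-at-c-2 : pair c₁ ≡ 1
    pair-at-c-2 = cong₂ _*_ (isGap-gap Λ c₁∉) (trans (cong (isGap Λ) (m+n∸n≡m 1 c₁)) (isGap-gap Λ 1∉))
    1<c-2 : 1 < c₁
    1<c-2 with m≤n⇒m<n∨m≡n d≤c-2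
    ... | inj₁ d<c-2 = ≤-trans (s≤s 1≤d) d<c-2
    ... | inj₂ refl  = ⊥-elim (c₁∉ d∈)

  c-2∈-if-few-pairs : pairs < 2 → c₁ ∈ Λ
  c-2∈-if-few-pairs few with Λ c₁ ≟ᴮ true
  ... | yes c₁∈ = c₁∈
  ... | no  c₁∉ = ⊥-elim (<⇒≱ few (two-pairs-if-c-2∉ c₁∉))

  pairs-symmetric : IsSymmetric Λ → pairs ≡ 0
  pairs-symmetric (c₂ , g , cond₂ , genus , c₂≡2g) = +-cancelˡ-≡ c pairs 0 (begin
    c + pairs         ≡⟨ sym twice-genus ⟩
    2 * gapsBelow Λ c ≡⟨ cong (2 *_) (sym (genus≡gapsBelow cond genus)) ⟩
    2 * g             ≡⟨ sym c₂≡2g ⟩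
    c₂                ≡⟨ conductor-unique cond₂ cond ⟩
    c                 ≡⟨ sym (+-identityʳ c) ⟩
    c + 0             ∎)
    where open ≡-Reasoning

  pairs-pseudo-symmetric : IsPseudoSymmetric Λ → pairs ≡ 1
  pairs-pseudo-symmetric (c₂ , g , cond₂ , genus , c₂≡2g-1) = sym (+-cancelˡ-≡ (suc c₁) 1 pairs (begin
    suc c₁ + 1            ≡⟨ +-comm (suc c₁) 1 ⟩
    c                     ≡⟨ sym (conductor-unique cond₂ cond) ⟩
    c₂                    ≡⟨ c₂≡2g-1 ⟩
    2 * g ∸ 1             ≡⟨ cong (λ n → 2 * n ∸ 1) (genus≡gapsBelow cond genus) ⟩
    2 * gapsBelow Λ c ∸ 1 ≡⟨ cong (_∸ 1) twice-genus ⟩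
    suc c₁ + pairs        ∎))
    where open ≡-Reasoning

  symmetric-dual : pairs ≡ 0 → ∀ x → x ≤ suc c₁ → ¬ x ∈ Λ → (suc c₁ ∸ x) ∈ Λ
  symmetric-dual none x x≤c-1 x∉ with Λ (suc c₁ ∸ x) ≟ᴮ true
  ... | yes y∈ = y∈
  ... | no  y∉ = ⊥-elim (1+n≰n (begin
    1                                 ≡⟨ sym (cong₂ _*_ (isGap-gap Λ x∉) (isGap-gap Λ y∉)) ⟩
    isGap Λ x * isGap Λ (suc c₁ ∸ x)  ≤⟨ term≤sumBelow (λ z → isGap Λ z * isGap Λ (suc c₁ ∸ z)) (s≤s x≤c-1) ⟩
    pairs                             ≡⟨ none ⟩
    0                                 ∎))
    where open ≤-Reasoning

  -- Without gap pairs, c = c' + m for the least positive element m: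
  -- c - c' is the dual of the gap c' - 1, and c - 1 - m is a gap below c'.
  symmetric-subconductor : pairs ≡ 0 → ∀ m → m ∈ Λ → 0 < m → (∀ x → x ∈ Λ → 0 < x → m ≤ x) →
                           c' + m ≡ c
  symmetric-subconductor none m m∈ 0<m m-least = ≤-antisym c'+m≤c c≤c'+m
    where
    open ≤-Reasoning
    p : ℕ
    p = pred c'
    c'≡1+p : c' ≡ suc p
    c'≡1+p = sym (suc-pred c' {{>-nonZero 0<c'}})
    p<c-1 : p < suc c₁
    p<c-1 = ≤-trans (≤-reflexive (sym c'≡1+p)) (≤-trans c'≤d (m≤n⇒m≤1+n d≤c-2))
    dual-p∈ : (suc c₁ ∸ p) ∈ Λ
    dual-p∈ = symmetric-dual none p (<⇒≤ p<c-1) (subconductor-pred-gap sub 0<c')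
    c'+m≤c : c' + m ≤ c
    c'+m≤c = begin
      c' + m                 ≤⟨ +-monoʳ-≤ c' (m-least _ dual-p∈ (m<n⇒0<n∸m p<c-1)) ⟩
      c' + (suc c₁ ∸ p)      ≡⟨ cong (_+ (suc c₁ ∸ p)) c'≡1+p ⟩
      suc (p + (suc c₁ ∸ p)) ≡⟨ cong suc (m+[n∸m]≡n (<⇒≤ p<c-1)) ⟩
      c                      ∎
    m≤c-1 : m ≤ suc c₁
    m≤c-1 = ≤-trans (m-least d d∈ 1≤d) (m≤n⇒m≤1+n d≤c-2)
    q : ℕ
    q = suc c₁ ∸ m
    q∉ : ¬ q ∈ Λ
    q∉ q∈ = no-complementary-pair c-1∉ q (m∸n≤m (suc c₁) m)
              (q∈ , subst (_∈ Λ) (sym (m∸[m∸n]≡n m≤c-1)) m∈)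
    q≤d : q ≤ d
    q≤d = ≤-trans (∸-monoʳ-≤ (suc c₁) 0<m)
                  (≤dominant c₁ (c-2∈-if-few-pairs (subst (_< 2) (sym none) (s≤s z≤n))) c-2<c)
    q<c' : q < c'
    q<c' with q <? c'
    ... | yes q<c' = q<c'
    ... | no  q≮c' = ⊥-elim (q∉ ([c',d]⊆Λ q (≮⇒≥ q≮c') q≤d))
    c≤c'+m : c ≤ c' + m
    c≤c'+m = begin
      c           ≡⟨ cong suc (sym (m∸n+n≡m m≤c-1)) ⟩
      suc (q + m) ≤⟨ +-monoˡ-≤ m q<c' ⟩
      c' + m      ∎

  -- Arf: if c' < d then d - 1, d ∈ Λ would force d + 1 ∈ Λ.
  arf-d≤c' : ∀ {λ'} → IsEnumeration Λ λ' → IsArf Λ λ' → d ≤ c'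
  arf-d≤c' enum arf with c' <? d
  ... | no  c'≮d = ≮⇒≥ c'≮d
  ... | yes c'<d = ⊥-elim (d+1∉ (arf-successor arf d 1≤d d-1∈ d∈))
    where
    open Enumeration NS enum
    d-1∈ : pred d ∈ Λ
    d-1∈ = [c',d]⊆Λ (pred d) (<⇒≤pred c'<d) pred[n]≤n

  -- Generated by {i,…,j}: let [K i, K j] be the block containing d.
  module IntervalCase {i j : ℕ} (GI : GeneratedByInterval Λ i j) where
    open IntervalGenerated NS GI

    1≤j : 1 ≤ j
    1≤j = ≤-trans (proj₁ GI) i≤j

    block-bound : ∀ k → suc k * i ≤ d → d ≤ suc k * j → c + c' ≤ 2 * d + 2
    block-bound k Ki≤d d≤Kj = begin
      c + c'                      ≤⟨ +-mono-≤ c≤K'i c'≤Ki ⟩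
      suc K * i + K * i           ≤⟨ interval-arithmetic k i j i≤j blocks-meet ⟩
      2 * (K * j) + 2             ≤⟨ +-monoˡ-≤ 2 (*-monoʳ-≤ 2 Kj≤d) ⟩
      2 * d + 2                   ∎
      where
      open ≤-Reasoning
      K : ℕ
      K = suc k
      -- The block ends exactly at d, as d + 1 is a gap …
      Kj≤d : K * j ≤ d
      Kj≤d with K * j ≤? d
      ... | yes Kj≤d = Kj≤d
      ... | no  Kj≰d = ⊥-elim (d+1∉ (block⇒member K (suc d) (m≤n⇒m≤1+n Ki≤d) (≰⇒> Kj≰d)))
      -- … and it lies inside Λ, so it starts at or after c'.
      c'≤Ki : c' ≤ K * i
      c'≤Ki = c'-least (K * i) (block⇒member K (K * i) ≤-refl (*-monoʳ-≤ K i≤j))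
                (λ t Ki≤t t≤d → block⇒member K t Ki≤t (≤-trans t≤d d≤Kj))
      -- The next block starts after d + 1, hence at or after c.
      d<K'i : d < suc K * i
      d<K'i with suc K * i ≤? d
      ... | no  K'i≰d = ≰⇒> K'i≰d
      ... | yes K'i≤d = ⊥-elim (d+1∉ (block⇒member (suc K) (suc d) (m≤n⇒m≤1+n K'i≤d)
                                        (≤-trans (s≤s d≤Kj) (+-monoˡ-≤ (K * j) 1≤j))))
      c≤K'i : c ≤ suc K * i
      c≤K'i with suc K * i <? c
      ... | no  K'i≮c = ≮⇒≥ K'i≮c
      ... | yes K'i<c = ⊥-elim (<⇒≱ d<K'i
                          (≤dominant _ (block⇒member (suc K) _ ≤-refl (*-monoʳ-≤ (suc K) i≤j)) K'i<c))
      -- (K+1) j + 1 ≥ c lies in a block of index ≥ K + 2, so (K+2) i ≤ (K+1) j + 1.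
      c≤n₀ : c ≤ suc (suc K * j)
      c≤n₀ = ≤-trans c≤K'i (≤-trans (*-monoʳ-≤ (suc K) i≤j) (n≤1+n _))
      blocks-meet : suc (suc K) * i ≤ suc K * j + 1
      blocks-meet with member⇒block (suc (suc K * j)) (proj₁ cond _ c≤n₀)
      ... | K′ , K′i≤n₀ , n₀≤K′j with suc (suc K) ≤? K′
      ...   | yes K+2≤K′ = ≤-trans (*-monoˡ-≤ i K+2≤K′) (≤-trans K′i≤n₀ (≤-reflexive (+-comm 1 _)))
      ...   | no  K+2≰K′ = ⊥-elim (1+n≰n (≤-trans n₀≤K′j (*-monoˡ-≤ j (s≤s⁻¹ (≰⇒> K+2≰K′)))))

    interval-bound : c + c' ∸ 2 ≤ 2 * d
    interval-bound with member⇒block d d∈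
    ... | zero  , _    , d≤0 = ⊥-elim (1+n≰n (≤-trans 1≤d d≤0))
    ... | suc k , Ki≤d , d≤Kj =
      s≤s⁻¹ (s≤s⁻¹ (subst (c + c' ≤_) (+-comm (2 * d) 2) (block-bound k Ki≤d d≤Kj)))

mainTheorem13 : (Λ : Subset) → IsNumericalSemigroup Λ →
    (λ' : ℕ → ℕ) → IsEnumeration Λ λ' →
    (c c' d : ℕ) → IsConductor Λ c → ¬ IsOrdinary Λ c →
    IsDominant Λ c d → IsSubconductor Λ d c' →
    (IsSymmetric Λ → ((c + c' ∸ 2) ⊓ (2 * d) ≡ c + c' ∸ 2) × (c + c' ∸ 2 ≡ 2 * c ∸ 2 ∸ λ' 1))
    × (IsPseudoSymmetric Λ → (c + c' ∸ 2) ⊓ (2 * d) ≡ c + c' ∸ 2)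
    × (IsArf Λ λ' → (c + c' ∸ 2) ⊓ (2 * d) ≡ 2 * d)
    × (IsGeneratedByAnInterval Λ → (c + c' ∸ 2) ⊓ (2 * d) ≡ c + c' ∸ 2)
mainTheorem13 Λ NS λ' enum c c' d cond nonord dom sub with Semigroup.conductor-shape NS cond dom
... | c₁ , refl = symmetric , pseudo-symmetric , arf , interval-generated
  where
  open NonOrdinary NS cond nonord dom sub hiding (c)
  open Enumeration NS enum

  symmetric : IsSymmetric Λ → ((c + c' ∸ 2) ⊓ (2 * d) ≡ c + c' ∸ 2) × (c + c' ∸ 2 ≡ 2 * c ∸ 2 ∸ λ' 1)
  symmetric symm =
      min-if-c-2∈ (c-2∈-if-few-pairs (subst (_< 2) (sym none) (s≤s z≤n)))
    , symmetric-arithmetic c c' (λ' 1)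
        (symmetric-subconductor none (λ' 1) λ-one∈ λ-one-positive λ-one-least)
    where
    none : pairs ≡ 0
    none = pairs-symmetric symm

  pseudo-symmetric : IsPseudoSymmetric Λ → (c + c' ∸ 2) ⊓ (2 * d) ≡ c + c' ∸ 2
  pseudo-symmetric pseudo =
    min-if-c-2∈ (c-2∈-if-few-pairs (subst (_< 2) (sym (pairs-pseudo-symmetric pseudo)) (s≤s (s≤s z≤n))))

  arf : IsArf Λ λ' → (c + c' ∸ 2) ⊓ (2 * d) ≡ 2 * d
  arf isArf = min-if-d≤c' (arf-d≤c' enum isArf)

  interval-generated : IsGeneratedByAnInterval Λ → (c + c' ∸ 2) ⊓ (2 * d) ≡ c + c' ∸ 2
  interval-generated (i , j , GI) = m≤n⇒m⊓n≡m (IntervalCase.interval-bound GI)
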